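{- For every integer $s\ge 2$ there is an integer $N=N(s)$ such that every connected finite simple graph $G$ with $n=n(G)\ge N$ vertices satisfies $\pi^{c}(G)\le n-s$.
   Context: A configuration of cops on $G$ is a function $C:V(G)\to\mathbb{Z}_{\ge 0}$ of size $\sum_v C(v)$. A pebbling step from a vertex $u$ with at least two cops to an adjacent vertex $v$ removes two cops from $u$ and adds one cop to $v$. In the cops and robbers pebbling game, cops are placed according to $C$, then a robber chooses a starting vertex; thereafter, in each turn the cops make pebbling steps, after which the robber either moves to an adjacent vertex or stays put. The robber is captured when he occupies a vertex holding at least one cop. The cop pebbling number $\pi^{c}(G)$ is the minimum $m$ such that some configuration of size $m$ allows the cops to capture the robber regardless of how he starts and moves. -}

module Defs where

open import Data.Nat using (ℕ; suc; _+_; _∸_; _≤_)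
open import Data.Fin using (Fin; _≟_)
open import Data.Fin.Properties using ()
open import Data.Bool using (Bool; true; false)
open import Data.List using (map; allFin)
open import Data.Nat.ListAction using (sum)
open import Data.Product using (Σ; ∃; _×_)
open import Data.Sum using (_⊎_)
open import Relation.Nullary using (yes; no)
open import Relation.Binary.PropositionalEquality using (_≡_)
open import Relation.Binary.Construct.Closure.ReflexiveTransitive using (Star)

record SimpleGraph (n : ℕ) : Set where
  field
    adj    : Fin n → Fin n → Bool
    sym    : ∀ u v → adj u v ≡ adj v u
    irrefl : ∀ v → adj v v ≡ false

open SimpleGraph public

Adj : ∀ {n} → SimpleGraph n → Fin n → Fin n → Set
Adj G u v = adj G u v ≡ true

Connected : ∀ {n} → SimpleGraph n → Set
Connected {n} G = ∀ (u v : Fin n) → Star (Adj G) u v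

Config : ℕ → Set
Config n = Fin n → ℕ

size : ∀ {n} → Config n → ℕ
size {n} C = sum (map C (allFin n))

move : ∀ {n} → Config n → Fin n → Fin n → Config n
move C u v w with w ≟ u
... | yes _ = C u ∸ 2
... | no _ with w ≟ v
...   | yes _ = suc (C v)
...   | no _  = C w

data Step {n} (G : SimpleGraph n) : Config n → Config n → Set where
  step : ∀ {C} u v → Adj G u v → 2 ≤ C u → Step G C (move C u v)

CopTurn : ∀ {n} → SimpleGraph n → Config n → Config n → Set
CopTurn G = Star (Step G)

RobberMove : ∀ {n} → SimpleGraph n → Fin n → Fin n → Set
RobberMove G r r' = r ≡ r' ⊎ Adj G r r'

-- CopsWin G C r : cops (with configuration C, about to move) can force capture
-- of the robber currently at r in finitely many rounds (least fixed point).
data CopsWin {n} (G : SimpleGraph n) : Config n → Fin n → Set where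
  win : ∀ {C r} →
        (Σ (Config n) λ C' → CopTurn G C C' ×
           (1 ≤ C' r ⊎ (∀ r' → RobberMove G r r' → 1 ≤ C' r' ⊎ CopsWin G C' r'))) →
        CopsWin G C r

Winning : ∀ {n} → SimpleGraph n → Config n → Set
Winning {n} G C = ∀ (r : Fin n) → 1 ≤ C r ⊎ CopsWin G C r

-- π^c(G) ≤ m  iff some winning configuration has size at most m
CopPebblingAtMost : ∀ {n} → SimpleGraph n → ℕ → Set
CopPebblingAtMost {n} G m = Σ (Config n) λ C → size C ≤ m × Winning G C

-- If some vertex u has more than s neighbours, put two cops on u, none on its
-- neighbours and one on every other vertex.  Otherwise every degree is at most s,
-- so the ball of radius j around a root has at most (s+1)^j vertices; as soon as
-- n > (s+1)^(3s-2), breadth-first search reaches a vertex at distance 3s-1, and a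
-- geodesic to it is a simple path on 3s vertices.  Cut it into s consecutive
-- triples and put two cops on each middle vertex, none on the two ends and one
-- everywhere else.  In both configurations every empty vertex is adjacent to a
-- vertex holding two cops, so the robber is caught in the first cop turn, and
-- there are at most n - s cops.
module Submission where

open import Defs hiding (sym)
open import Defs using () renaming (sym to adj-sym)
open import Algebra.Properties.CommutativeMonoid.Sum as ℕ-Sum using ()
open import Data.Bool as Bool using (true; if_then_else_)
open import Data.Empty using (⊥-elim)
open import Data.Fin using (Fin; zero; suc; _≟_; fromℕ<)
open import Data.Fin.Properties using (any?; ¬∀⟶∃¬; injective⇒≤)
open import Data.List using (List; []; _∷_; [_]; _++_; filter; concatMap; allFin; tabulate; length; lookup)
open import Data.List.Properties using (length-++; map-tabulate)
open import Data.List.Membership.Propositional using (_∈_; _∉_; find)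
open import Data.List.Membership.Propositional.Properties using (∈-++⁺ˡ; ∈-++⁺ʳ; ∈-++⁻; ∈-allFin; ∈-filter⁺; ∈-filter⁻; ∈-concatMap⁺; ∈-concatMap⁻)
open import Data.List.Relation.Binary.Disjoint.Propositional using (Disjoint)
open import Data.List.Relation.Binary.Subset.Propositional using (_⊆_)
open import Data.List.Relation.Unary.All as All using (All; []; _∷_)
open import Data.List.Relation.Unary.All.Properties using (anti-mono)
open import Data.List.Relation.Unary.Any as Any using (here; there; index)
open import Data.List.Relation.Unary.Any.Properties using (lookup-index)
open import Data.List.Relation.Unary.Linked as Linked using (Linked; []; [-]; _∷_)
open import Data.List.Relation.Unary.Unique.Propositional using (Unique; []; _∷_)
open import Data.List.Relation.Unary.Unique.Propositional.Properties using (allFin⁺; filter⁺; Unique[x∷xs]⇒x∉xs)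
open import Data.Nat using (ℕ; zero; suc; _+_; _*_; _∸_; _^_; _≤_; _<_; z≤n; s≤s)
open import Data.Nat.ListAction using (sum)
open import Data.Nat.Properties hiding (_≟_)
open import Data.Product using (Σ; ∃; ∃-syntax; ∃₂; _×_; _,_; proj₁; proj₂)
open import Data.Sum using (_⊎_; inj₁; inj₂)
open import Function using (_∘_; id)
open import Relation.Binary.Core using (Rel)
open import Relation.Binary.Definitions using (Symmetric)
open import Relation.Binary.PropositionalEquality using (_≡_; _≢_; refl; sym; trans; cong; cong₂; subst; module ≡-Reasoning)
open import Relation.Binary.Construct.Closure.ReflexiveTransitive using (Star; ε; _◅_)
open import Relation.Nullary using (¬_; yes; no; does)
open import Relation.Unary using (Pred; Decidable)

open ℕ-Sum +-0-commutativeMonoid using (sum-syntax; ∑-distrib-+; sum-cong-≗; sum-replicate-zero)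

size≡∑ : ∀ {n} (C : Config n) → size C ≡ ∑[ v < n ] C v
size≡∑ {n} C = trans (cong sum (map-tabulate id C)) (sum-tabulate C)
  where
  sum-tabulate : ∀ {m} (f : Fin m → ℕ) → sum (tabulate f) ≡ ∑[ v < m ] f v
  sum-tabulate {zero}  f = refl
  sum-tabulate {suc m} f = cong (f zero +_) (sum-tabulate (f ∘ suc))

∑-const-1 : ∀ n → ∑[ v < n ] 1 ≡ n
∑-const-1 zero    = refl
∑-const-1 (suc n) = cong suc (∑-const-1 n)

δ : ∀ {n} → Fin n → Fin n → ℕ
δ x v = if does (x ≟ v) then 1 else 0

∑-δ : ∀ {n} (x : Fin n) → ∑[ v < n ] δ x v ≡ 1
∑-δ {suc n} zero    = cong suc (sum-replicate-zero n)
∑-δ {suc n} (suc x) = ∑-δ x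

multiplicity : ∀ {n} → List (Fin n) → Fin n → ℕ
multiplicity []       v = 0
multiplicity (x ∷ xs) v = δ x v + multiplicity xs v

module _ {n : ℕ} where

  ∑-multiplicity : (xs : List (Fin n)) → ∑[ v < n ] multiplicity xs v ≡ length xs
  ∑-multiplicity []       = sum-replicate-zero n
  ∑-multiplicity (x ∷ xs) = begin
    ∑[ v < n ] (δ x v + multiplicity xs v)            ≡⟨ ∑-distrib-+ (δ x) (multiplicity xs) ⟩
    ∑[ v < n ] δ x v + ∑[ v < n ] multiplicity xs v  ≡⟨ cong₂ _+_ (∑-δ x) (∑-multiplicity xs) ⟩
    suc (length xs)                                  ∎
    where open ≡-Reasoning

  multiplicity-∉ : ∀ {v} {xs : List (Fin n)} → v ∉ xs → multiplicity xs v ≡ 0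
  multiplicity-∉ {xs = []}     _  = refl
  multiplicity-∉ {v} {x ∷ xs} v∉ with x ≟ v
  ... | yes refl = ⊥-elim (v∉ (here refl))
  ... | no _     = multiplicity-∉ (v∉ ∘ there)

  multiplicity-∈ : ∀ {v} {xs : List (Fin n)} → v ∈ xs → 1 ≤ multiplicity xs v
  multiplicity-∈ {v} (here refl) with v ≟ v
  ... | yes _   = s≤s z≤n
  ... | no v≢v  = ⊥-elim (v≢v refl)
  multiplicity-∈ {v} {x ∷ _} (there v∈) = ≤-trans (multiplicity-∈ v∈) (m≤n+m _ (δ x v))

  multiplicity-unique : ∀ {v} {xs : List (Fin n)} → Unique xs → multiplicity xs v ≤ 1
  multiplicity-unique [] = z≤n
  multiplicity-unique {v} {x ∷ _} u@(_ ∷ u′) with x ≟ v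
  ... | yes refl = ≤-reflexive (cong suc (multiplicity-∉ (Unique[x∷xs]⇒x∉xs u)))
  ... | no _     = multiplicity-unique u′

module _ {a} {A : Set a} where

  middles : List A → List A
  middles (x ∷ y ∷ z ∷ xs) = y ∷ middles xs
  middles _                = []

  ends : List A → List A
  ends (x ∷ y ∷ z ∷ xs) = x ∷ z ∷ ends xs
  ends _                = []

  middles-⊆ : ∀ xs → middles xs ⊆ xs
  middles-⊆ (x ∷ y ∷ z ∷ xs) (here refl) = there (here refl)
  middles-⊆ (x ∷ y ∷ z ∷ xs) (there v∈)  = there (there (there (middles-⊆ xs v∈)))

  ends-⊆ : ∀ xs → ends xs ⊆ xs
  ends-⊆ (x ∷ y ∷ z ∷ xs) (here refl)         = here refl
  ends-⊆ (x ∷ y ∷ z ∷ xs) (there (here refl)) = there (there (here refl))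
  ends-⊆ (x ∷ y ∷ z ∷ xs) (there (there v∈))  = there (there (there (ends-⊆ xs v∈)))

  length-middles : ∀ k xs → length xs ≡ k * 3 → length (middles xs) ≡ k
  length-middles zero    []               _  = refl
  length-middles (suc k) (x ∷ y ∷ z ∷ xs) eq =
    cong suc (length-middles k xs (suc-injective (suc-injective (suc-injective eq))))

  length-ends : ∀ xs → length (ends xs) ≡ length (middles xs) + length (middles xs)
  length-ends []               = refl
  length-ends (x ∷ [])         = refl
  length-ends (x ∷ y ∷ [])     = refl
  length-ends (x ∷ y ∷ z ∷ xs) = cong suc (trans (cong suc (length-ends xs)) (sym (+-suc _ _)))

  ends-unique : ∀ {xs} → Unique xs → Unique (ends xs)
  ends-unique {[]}             _ = []
  ends-unique {x ∷ []}         _ = []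
  ends-unique {x ∷ y ∷ []}     _ = []
  ends-unique {x ∷ y ∷ z ∷ xs} ((_ ∷ x≢z ∷ x∉xs) ∷ _ ∷ (z∉xs ∷ u)) =
    (x≢z ∷ anti-mono (ends-⊆ xs) x∉xs) ∷ anti-mono (ends-⊆ xs) z∉xs ∷ ends-unique u

  middles-ends-disjoint : ∀ {xs} → Unique xs → Disjoint (middles xs) (ends xs)
  middles-ends-disjoint {x ∷ y ∷ z ∷ xs} ((x≢y ∷ _ ∷ x∉xs) ∷ (y≢z ∷ y∉xs) ∷ (z∉xs ∷ u)) =
    disjoint
    where
    disjoint : Disjoint (y ∷ middles xs) (x ∷ z ∷ ends xs)
    disjoint (here refl , here refl)          = x≢y refl
    disjoint (here refl , there (here refl))  = y≢z refl
    disjoint (here refl , there (there v∈))   = All.lookup y∉xs (ends-⊆ xs v∈) refl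
    disjoint (there v∈  , here refl)          = All.lookup x∉xs (middles-⊆ xs v∈) refl
    disjoint (there v∈  , there (here refl))  = All.lookup z∉xs (middles-⊆ xs v∈) refl
    disjoint (there v∈  , there (there v∈′))  = middles-ends-disjoint u (v∈ , v∈′)

  ends-near-middles : ∀ {r} {R : Rel A r} → Symmetric R → ∀ {xs v} → Linked R xs → v ∈ ends xs →
                      ∃[ t ] t ∈ middles xs × R t v
  ends-near-middles sym-R (xRy ∷ yRz ∷ _) (here refl)         = _ , here refl , sym-R xRy
  ends-near-middles sym-R (xRy ∷ yRz ∷ _) (there (here refl)) = _ , here refl , yRz
  ends-near-middles sym-R (_ ∷ _ ∷ linked) (there (there v∈))
    with ends-near-middles sym-R (Linked.tail linked) v∈
  ... | t , t∈ , tRv = t , there t∈ , tRv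

star-exit : ∀ {a r p} {A : Set a} {R : Rel A r} {P : Pred A p} → Decidable P →
            ∀ {x y} → Star R x y → P x → ¬ P y → ∃₂ λ u v → P u × ¬ P v × R u v
star-exit P? ε               Px ¬Py = ⊥-elim (¬Py Px)
star-exit P? (_◅_ {j = z} xRz z⋆y) Px ¬Py with P? z
... | yes Pz = star-exit P? z⋆y Pz ¬Py
... | no ¬Pz = _ , z , Px , ¬Pz , xRz

covering-length : ∀ {n} {xs : List (Fin n)} → (∀ v → v ∈ xs) → n ≤ length xs
covering-length {xs = xs} covers = injective⇒≤ {f = index ∘ covers} index-injective
  where
  index-injective : ∀ {u v} → index (covers u) ≡ index (covers v) → u ≡ v
  index-injective {u} {v} eq =
    trans (lookup-index (covers u)) (trans (cong (lookup xs) eq) (sym (lookup-index (covers v))))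

length-concatMap-≤ : ∀ {a b} {A : Set a} {B : Set b} {f : A → List B} {d} →
                     (∀ x → length (f x) ≤ d) → ∀ xs → length (concatMap f xs) ≤ d * length xs
length-concatMap-≤ {d = d} bounded []       = ≤-reflexive (sym (*-zeroʳ d))
length-concatMap-≤ {f = f} {d} bounded (x ∷ xs) = begin
  length (f x ++ concatMap f xs)           ≡⟨ length-++ (f x) ⟩
  length (f x) + length (concatMap f xs)   ≤⟨ +-mono-≤ (bounded x) (length-concatMap-≤ bounded xs) ⟩
  d + d * length xs                        ≡⟨ *-suc d (length xs) ⟨
  d * suc (length xs)                      ∎
  where open ≤-Reasoning

CopPebblingAtMost-mono : ∀ {n} {G : SimpleGraph n} {m m′} → m ≤ m′ →
                         CopPebblingAtMost G m → CopPebblingAtMost G m′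
CopPebblingAtMost-mono m≤m′ (C , size≤m , winning) = C , ≤-trans size≤m m≤m′ , winning

module _ {n : ℕ} (G : SimpleGraph n) where

  open import Data.List.Membership.DecPropositional (_≟_ {n}) using (_∈?_)

  Adj-sym : Symmetric (Adj G)
  Adj-sym {u} {v} u~v = trans (adj-sym G v u) u~v

  Adj⇒≢ : ∀ {u v} → Adj G u v → u ≢ v
  Adj⇒≢ {u} u~u refl with trans (sym u~u) (irrefl G u)
  ... | ()

  move-fills-target : ∀ (C : Config n) {u v} → Adj G u v → 1 ≤ move C u v v
  move-fills-target C {u} {v} u~v with v ≟ u
  ... | yes refl = ⊥-elim (Adj⇒≢ u~v refl)
  ... | no _ with v ≟ v
  ...   | yes _  = s≤s z≤n
  ...   | no v≢v = ⊥-elim (v≢v refl)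

  Guarding : Config n → Set
  Guarding C = ∀ r → 1 ≤ C r ⊎ ∃[ t ] Adj G t r × 2 ≤ C t

  guarding⇒winning : ∀ {C} → Guarding C → Winning G C
  guarding⇒winning {C} guard r with guard r
  ... | inj₁ occupied          = inj₁ occupied
  ... | inj₂ (t , t~r , 2≤Ct) =
    inj₂ (win (move C t r , step t r t~r 2≤Ct ◅ ε , inj₁ (move-fills-target C t~r)))

  hubLeafConfig : List (Fin n) → List (Fin n) → Config n
  hubLeafConfig H L v = suc (multiplicity H v) ∸ multiplicity L v

  module _ (H L : List (Fin n)) (unique-L : Unique L) (disjoint : Disjoint H L)
           (near-hub : ∀ {v} → v ∈ L → ∃[ t ] t ∈ H × Adj G t v) where

    hubLeafConfig-∉ : ∀ {v} → v ∉ L → hubLeafConfig H L v ≡ suc (multiplicity H v)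
    hubLeafConfig-∉ v∉L = cong (suc (multiplicity H _) ∸_) (multiplicity-∉ v∉L)

    hubLeafConfig-guarding : Guarding (hubLeafConfig H L)
    hubLeafConfig-guarding r with r ∈? L
    ... | no r∉L  = inj₁ (subst (1 ≤_) (sym (hubLeafConfig-∉ r∉L)) (s≤s z≤n))
    ... | yes r∈L with near-hub r∈L
    ...   | t , t∈H , t~r = inj₂ (t , t~r , subst (2 ≤_) (sym (hubLeafConfig-∉ t∉L)) (s≤s (multiplicity-∈ t∈H)))
      where
      t∉L : t ∉ L
      t∉L t∈L = disjoint (t∈H , t∈L)

    hubLeafConfig-size : size (hubLeafConfig H L) ≡ n + length H ∸ length L
    hubLeafConfig-size = begin
      size C                                ≡⟨ size≡∑ C ⟩
      ∑[ v < n ] C v                        ≡⟨ m+n∸n≡m _ (length L) ⟨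
      ∑[ v < n ] C v + length L ∸ length L  ≡⟨ cong (_∸ length L) balance ⟩
      n + length H ∸ length L               ∎
      where
      open ≡-Reasoning
      C = hubLeafConfig H L
      leaves-bounded : ∀ v → multiplicity L v ≤ suc (multiplicity H v)
      leaves-bounded v = ≤-trans (multiplicity-unique unique-L) (s≤s z≤n)
      balance : ∑[ v < n ] C v + length L ≡ n + length H
      balance = begin
        ∑[ v < n ] C v + length L                     ≡⟨ cong (∑[ v < n ] C v +_) (∑-multiplicity L) ⟨
        ∑[ v < n ] C v + ∑[ v < n ] multiplicity L v  ≡⟨ ∑-distrib-+ C (multiplicity L) ⟨
        ∑[ v < n ] (C v + multiplicity L v)           ≡⟨ sum-cong-≗ (λ v → m∸n+n≡m (leaves-bounded v)) ⟩
        ∑[ v < n ] (1 + multiplicity H v)             ≡⟨ ∑-distrib-+ (λ _ → 1) (multiplicity H) ⟩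
        ∑[ v < n ] 1 + ∑[ v < n ] multiplicity H v    ≡⟨ cong₂ _+_ (∑-const-1 n) (∑-multiplicity H) ⟩
        n + length H                                  ∎

    hubs⇒pebbling : CopPebblingAtMost G (n + length H ∸ length L)
    hubs⇒pebbling = hubLeafConfig H L , ≤-reflexive hubLeafConfig-size , guarding⇒winning hubLeafConfig-guarding

  Adj? : ∀ u → Decidable (Adj G u)
  Adj? u v = adj G u v Bool.≟ true

  neighbours : Fin n → List (Fin n)
  neighbours u = filter (Adj? u) (allFin n)

  degree : Fin n → ℕ
  degree u = length (neighbours u)

  ∈-neighbours⁺ : ∀ {u v} → Adj G u v → v ∈ neighbours u
  ∈-neighbours⁺ {u} u~v = ∈-filter⁺ (Adj? u) (∈-allFin _) u~v

  ∈-neighbours⁻ : ∀ {u v} → v ∈ neighbours u → Adj G u v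
  ∈-neighbours⁻ {u} = proj₂ ∘ ∈-filter⁻ (Adj? u) {xs = allFin n}

  highDegree⇒pebbling : ∀ {s} u → s < degree u → CopPebblingAtMost G (n ∸ s)
  highDegree⇒pebbling {s} u s<deg =
    CopPebblingAtMost-mono (≤-trans (∸-monoʳ-≤ (n + 1) s<deg) (≤-reflexive (cong (_∸ suc s) (+-comm n 1))))
      (hubs⇒pebbling [ u ] (neighbours u) (filter⁺ (Adj? u) (allFin⁺ n)) u∉neighbours
                     (λ v∈ → u , here refl , ∈-neighbours⁻ v∈))
    where
    u∉neighbours : Disjoint [ u ] (neighbours u)
    u∉neighbours (here refl , u∈) = Adj⇒≢ (∈-neighbours⁻ u∈) refl

  SimplePath : ℕ → Set
  SimplePath k = ∃[ ps ] length ps ≡ k × Linked (Adj G) ps × Unique ps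

  simplePath⇒pebbling : ∀ k → SimplePath (k * 3) → CopPebblingAtMost G (n ∸ k)
  simplePath⇒pebbling k (ps , length≡ , walk , unique) =
    subst (CopPebblingAtMost G) bound
      (hubs⇒pebbling (middles ps) (ends ps) (ends-unique unique) (middles-ends-disjoint unique)
                     (ends-near-middles Adj-sym walk))
    where
    open ≡-Reasoning
    m = length (middles ps)
    bound : n + m ∸ length (ends ps) ≡ n ∸ k
    bound = begin
      n + m ∸ length (ends ps) ≡⟨ cong (n + m ∸_) (length-ends ps) ⟩
      n + m ∸ (m + m)          ≡⟨ cong (_∸ (m + m)) (+-comm n m) ⟩
      m + n ∸ (m + m)          ≡⟨ [m+n]∸[m+o]≡n∸o m n m ⟩
      n ∸ m                    ≡⟨ cong (n ∸_) (length-middles k ps length≡) ⟩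
      n ∸ k                    ∎

  module BreadthFirst (root : Fin n) where

    ball : ℕ → List (Fin n)
    ball zero    = [ root ]
    ball (suc j) = ball j ++ concatMap neighbours (ball j)

    ball-⊆ : ∀ j → ball j ⊆ ball (suc j)
    ball-⊆ j = ∈-++⁺ˡ

    root∈ball : ∀ j → root ∈ ball j
    root∈ball zero    = here refl
    root∈ball (suc j) = ball-⊆ j (root∈ball j)

    ball-step : ∀ j {p v} → p ∈ ball j → Adj G p v → v ∈ ball (suc j)
    ball-step j p∈ p~v =
      ∈-++⁺ʳ (ball j) (∈-concatMap⁺ neighbours (Any.map (λ { refl → ∈-neighbours⁺ p~v }) p∈))

    ball-parent : ∀ j {v} → v ∈ ball (suc j) → v ∉ ball j → ∃[ p ] p ∈ ball j × Adj G p v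
    ball-parent j v∈ v∉ with ∈-++⁻ (ball j) v∈
    ... | inj₁ v∈ball = ⊥-elim (v∉ v∈ball)
    ... | inj₂ v∈next with find (∈-concatMap⁻ neighbours {xs = ball j} v∈next)
    ...   | p , p∈ , v∈nbrs = p , p∈ , ∈-neighbours⁻ v∈nbrs

    length-ball : ∀ {Δ} → (∀ u → degree u ≤ Δ) → ∀ j → length (ball j) ≤ suc Δ ^ j
    length-ball bounded zero        = ≤-refl
    length-ball {Δ} bounded (suc j) = begin
      length (ball j ++ concatMap neighbours (ball j))           ≡⟨ length-++ (ball j) ⟩
      length (ball j) + length (concatMap neighbours (ball j))   ≤⟨ +-monoʳ-≤ _ (length-concatMap-≤ bounded (ball j)) ⟩
      length (ball j) + Δ * length (ball j)                      ≤⟨ +-mono-≤ ih (*-monoʳ-≤ Δ ih) ⟩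
      suc Δ ^ j + Δ * suc Δ ^ j                                  ∎
      where
      open ≤-Reasoning
      ih = length-ball bounded j

    Frontier : ℕ → Fin n → Set
    Frontier zero    v = v ∈ ball zero
    Frontier (suc j) v = v ∈ ball (suc j) × v ∉ ball j

    frontier-parent : ∀ j {v} → Frontier (suc j) v → ∃[ p ] Frontier j p × Adj G p v
    frontier-parent j (v∈ , v∉) with ball-parent j v∈ v∉
    frontier-parent zero    (v∈ , v∉) | p , p∈ , p~v = p , p∈ , p~v
    frontier-parent (suc j) (v∈ , v∉) | p , p∈ , p~v =
      p , (p∈ , λ p∈′ → v∉ (ball-step j p∈′ p~v)) , p~v

    geodesic : ∀ j {v} → Frontier j v →
               ∃[ ps ] length ps ≡ j × Linked (Adj G) (v ∷ ps) × Unique (v ∷ ps) × All (_∈ ball j) (v ∷ ps)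
    geodesic zero    v∈ = [] , refl , [-] , [] ∷ [] , v∈ ∷ []
    geodesic (suc j) frontier with frontier-parent j frontier
    ... | p , p-frontier , p~v with geodesic j p-frontier
    ...   | ps , length≡ , walk , unique , within =
      p ∷ ps , cong suc length≡ , Adj-sym p~v ∷ walk ,
      All.map (λ { w∈ refl → proj₂ frontier w∈ }) within ∷ unique ,
      proj₁ frontier ∷ All.map (ball-⊆ j) within

    frontier-exists : Connected G → ∀ j → length (ball j) < n → ∃ (Frontier (suc j))
    frontier-exists connected j small
      with ¬∀⟶∃¬ n (_∈ ball j) (_∈? ball j) (λ covers → <⇒≱ small (covering-length covers))
    ... | outside , outside∉
      with star-exit (_∈? ball j) (connected root outside) (root∈ball j) outside∉
    ...   | p , v , p∈ , v∉ , p~v = v , ball-step j p∈ p~v , v∉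

    long-simplePath : Connected G → ∀ {Δ} → (∀ u → degree u ≤ Δ) →
                      ∀ j → suc Δ ^ j < n → SimplePath (suc (suc j))
    long-simplePath connected bounded j small
      with frontier-exists connected j (≤-trans (s≤s (length-ball bounded j)) small)
    ... | v , frontier with geodesic (suc j) frontier
    ...   | ps , length≡ , walk , unique , _ = v ∷ ps , cong suc length≡ , walk , unique

  largeConnected⇒pebbling : Connected G → ∀ k → suc (suc k) ^ suc (k * 3) < n →
                            CopPebblingAtMost G (n ∸ suc k)
  largeConnected⇒pebbling connected k large with any? (λ u → suc k <? degree u)
  ... | yes (u , high) = highDegree⇒pebbling u high
  ... | no ¬high = simplePath⇒pebbling (suc k) (long-simplePath connected bounded (suc (k * 3)) large)
    where
    open BreadthFirst (fromℕ< (≤-trans (s≤s z≤n) large))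
    bounded : ∀ u → degree u ≤ suc k
    bounded u = ≮⇒≥ (¬high ∘ (u ,_))

corollary2 : ∀ (s : ℕ) → 2 ≤ s → Σ ℕ λ N → ∀ (n : ℕ) → N ≤ n →
    ∀ (G : SimpleGraph n) → Connected G → CopPebblingAtMost G (n ∸ s)
corollary2 zero    ()
corollary2 (suc k) _ =
  suc (suc (suc k) ^ suc (k * 3)) , λ n large G connected → largeConnected⇒pebbling G connected k large
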